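{- The hyperelliptic curves $y^2=x^5+x$ and $y^2=x^6+4x^5+10x^4-20x^2-16x-8$ are isomorphic over the number field $\mathbb{Q}(\theta)$, where $\theta=2^{3/4}(\sqrt2-1)^{3/4}$.
   Context: $\theta$ denotes the positive real number $2^{3/4}(\sqrt2-1)^{3/4}$. -}

module Defs where

open import Data.Nat using (ℕ; zero; suc)
open import Data.Integer using (+_; -[1+_])
open import Data.Rational.Unnormalised using (ℚᵘ; 0ℚᵘ; 1ℚᵘ; _/_; _≃_) renaming (_+_ to _+ℚ_; _*_ to _*ℚ_; -_ to -ℚ_)
open import Data.Vec.Relation.Binary.Pointwise.Inductive using (Pointwise)
open import Data.Vec using (Vec; []; _∷_; zipWith; replicate; toList)
import Data.Vec as V
open import Data.List using (List; []; _∷_; map; foldr)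
open import Relation.Binary.PropositionalEquality using (_≡_)

-- The number field K = ℚ(θ), θ = 2^{3/4}(√2-1)^{3/4}.
-- θ^4 = 8(√2-1)^3 = 40√2 - 56, hence (θ^4+56)^2 = 3200, i.e.
-- θ is a root of p(t) = t^8 + 112 t^4 - 64, which is irreducible over ℚ
-- ([ℚ(θ):ℚ] = 8).  So K ≅ ℚ[t]/(p(t)); an element is represented by its
-- coefficient vector (c₀,…,c₇) w.r.t. the basis 1, θ, …, θ⁷.
-- Rationals are the unnormalised ℚᵘ with their equality _≃_ (fast to
-- compute); equality in K is coefficientwise _≃_.

K : Set
K = Vec ℚᵘ 8

0K : K
0K = replicate 8 0ℚᵘ

const : ℚᵘ → K
const c = c ∷ replicate 7 0ℚᵘ

1K : K
1K = const 1ℚᵘ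

θ : K
θ = 0ℚᵘ ∷ 1ℚᵘ ∷ replicate 6 0ℚᵘ

infix 4 _≈K_

_≈K_ : K → K → Set
_≈K_ = Pointwise _≃_

infixl 6 _+K_
infixl 7 _*K_

_+K_ : K → K → K
_+K_ = zipWith _+ℚ_

-K_ : K → K
-K_ = V.map -ℚ_

scaleK : ℚᵘ → K → K
scaleK c = V.map (c *ℚ_)

-- multiplication by θ, using θ^8 = 64 - 112 θ^4
mulθ : K → K
mulθ (a0 ∷ a1 ∷ a2 ∷ a3 ∷ a4 ∷ a5 ∷ a6 ∷ a7 ∷ []) =
  (0ℚᵘ ∷ a0 ∷ a1 ∷ a2 ∷ a3 ∷ a4 ∷ a5 ∷ a6 ∷ [])
  +K scaleK a7 ((+ 64 / 1) ∷ 0ℚᵘ ∷ 0ℚᵘ ∷ 0ℚᵘ ∷ (-[1+ 111 ] / 1) ∷ 0ℚᵘ ∷ 0ℚᵘ ∷ 0ℚᵘ ∷ [])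

_*K_ : K → K → K
x *K y = foldr (λ c acc → scaleK c y +K mulθ acc) 0K (toList x)

-- Polynomials over K in one variable x, as coefficient lists
-- (lowest degree first).

PolyK : Set
PolyK = List K

addP : PolyK → PolyK → PolyK
addP [] q = q
addP (a ∷ p) [] = a ∷ p
addP (a ∷ p) (b ∷ q) = (a +K b) ∷ addP p q

mulP : PolyK → PolyK → PolyK
mulP [] q = []
mulP (a ∷ p) q = addP (map (a *K_) q) (0K ∷ mulP p q)

powP : PolyK → ℕ → PolyK
powP p zero = 1K ∷ []
powP p (suc n) = mulP p (powP p n)

scaleP : K → PolyK → PolyK
scaleP c = map (c *K_)

coeff : PolyK → ℕ → K
coeff [] n = 0K
coeff (a ∷ p) zero = a
coeff (a ∷ p) (suc n) = coeff p n

_≈P_ : PolyK → PolyK → Set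
p ≈P q = ∀ n → coeff p n ≈K coeff q n

-- Genus-2 hyperelliptic curves  y² = f(x),  deg f ∈ {5,6}, f given by its
-- 7 coefficients f₀,…,f₆ (a binary sextic form).

Sextic : Set
Sextic = Vec K 7

-- (c x + d)^6 · g((a x + b)/(c x + d)) = Σᵢ gᵢ (a x + b)^i (c x + d)^(6-i)
substSextic : Sextic → K → K → K → K → PolyK
substSextic g a b c d = go g 0 6
  where
  go : ∀ {m} → Vec K m → ℕ → ℕ → PolyK
  go [] i j = []
  go (gi ∷ gs) i j =
    addP (scaleP gi (mulP (powP (b ∷ a ∷ []) i) (powP (d ∷ c ∷ []) j)))
         (go gs (suc i) (Data.Nat.pred j))

sexticPoly : Sextic → PolyK
sexticPoly = toList

-- The curves y² = f(x) and y² = g(x) are isomorphic over K: there is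
-- (a b; c d) ∈ GL₂(K) and e ∈ K* such that
--   (x , y) ↦ ((a x + b)/(c x + d) , e y/(c x + d)³)
-- maps the first curve to the second, i.e.
--   e² f(x) = (c x + d)^6 g((a x + b)/(c x + d)).
-- (For genus 2 every isomorphism between the curves has this form.)
IsomorphicOverK : Sextic → Sextic → Set
IsomorphicOverK f g =
  Data.Product.Σ K λ a → Data.Product.Σ K λ b → Data.Product.Σ K λ c →
  Data.Product.Σ K λ d → Data.Product.Σ K λ e →
    (¬ (a *K d +K -K (b *K c) ≈K 0K)) Data.Product.×
    (¬ (e ≈K 0K)) Data.Product.×
    (scaleP (e *K e) (sexticPoly f) ≈P substSextic g a b c d)
  where
  open import Relation.Nullary using (¬_)
  import Data.Product

f₁ : Sextic
f₁ = 0K ∷ 1K ∷ 0K ∷ 0K ∷ 0K ∷ 1K ∷ 0K ∷ []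

f₂ : Sextic
f₂ = const (-[1+ 7 ] / 1) ∷ const (-[1+ 15 ] / 1) ∷ const (-[1+ 19 ] / 1)
   ∷ 0K ∷ const (+ 10 / 1) ∷ const (+ 4 / 1) ∷ 1K ∷ []

{-# OPTIONS --safe #-}
-- With √2 = (θ⁴ + 56)/40 ∈ K, the isomorphism is the Möbius map with
-- a = 160√2, b = 80 θ² (√2 + 1)², c = 160, d = −40 θ² (3√2 + 4).  Once these
-- witnesses are known, everything is a finite computation in
-- K = ℚ[t]/(t⁸ + 112 t⁴ − 64): equality in K and of polynomials over K is
-- decidable, and the three required facts are decided by evaluation.
module Submission where

open import Defs
open import Data.Nat using (zero; suc)
open import Data.Integer using (+_; -[1+_])
open import Data.Rational.Unnormalised using (0ℚᵘ; _/_)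
open import Data.Rational.Unnormalised.Properties using (_≃?_; ≃-refl)
open import Data.List using ([]; _∷_)
open import Data.Vec using ([]; _∷_)
import Data.Vec.Relation.Binary.Pointwise.Inductive as Pointwise
open import Data.Product using (_×_; _,_)
open import Relation.Nullary using (¬_; Dec; yes)
open import Relation.Nullary.Decidable using (map′; _×-dec_; from-yes; from-no)

infix 4 _≈K?_ _≈P?_

_≈K?_ : (x y : K) → Dec (x ≈K y)
_≈K?_ = Pointwise.decidable _≃?_

≈K-refl : ∀ {x} → x ≈K x
≈K-refl = Pointwise.refl ≃-refl

tailP : PolyK → PolyK
tailP []      = []
tailP (_ ∷ p) = p

≈P-cons : ∀ p q → coeff p 0 ≈K coeff q 0 × tailP p ≈P tailP q → p ≈P q
≈P-cons []      []      (eq₀ , _)  zero    = eq₀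
≈P-cons []      (_ ∷ _) (eq₀ , _)  zero    = eq₀
≈P-cons (_ ∷ _) []      (eq₀ , _)  zero    = eq₀
≈P-cons (_ ∷ _) (_ ∷ _) (eq₀ , _)  zero    = eq₀
≈P-cons []      []      (_ , eqₜ) (suc n) = eqₜ n
≈P-cons []      (_ ∷ _) (_ , eqₜ) (suc n) = eqₜ n
≈P-cons (_ ∷ _) []      (_ , eqₜ) (suc n) = eqₜ n
≈P-cons (_ ∷ _) (_ ∷ _) (_ , eqₜ) (suc n) = eqₜ n

≈P-uncons : ∀ p q → p ≈P q → coeff p 0 ≈K coeff q 0 × tailP p ≈P tailP q
≈P-uncons []      []      eq = eq 0 , λ n → eq (suc n)
≈P-uncons []      (_ ∷ _) eq = eq 0 , λ n → eq (suc n)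
≈P-uncons (_ ∷ _) []      eq = eq 0 , λ n → eq (suc n)
≈P-uncons (_ ∷ _) (_ ∷ _) eq = eq 0 , λ n → eq (suc n)

decideByHeadAndTail : ∀ p q → Dec (tailP p ≈P tailP q) → Dec (p ≈P q)
decideByHeadAndTail p q tail? =
  map′ (≈P-cons p q) (≈P-uncons p q) ((coeff p 0 ≈K? coeff q 0) ×-dec tail?)

-- A missing coefficient is 0K, so lists of different lengths are compared
-- by padding the shorter one with zeros.
_≈P?_ : (p q : PolyK) → Dec (p ≈P q)
[]      ≈P? []      = yes λ _ → ≈K-refl
[]      ≈P? (b ∷ q) = decideByHeadAndTail [] (b ∷ q) ([] ≈P? q)
(a ∷ p) ≈P? []      = decideByHeadAndTail (a ∷ p) [] (p ≈P? [])
(a ∷ p) ≈P? (b ∷ q) = decideByHeadAndTail (a ∷ p) (b ∷ q) (p ≈P? q)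

a b c d e : K
a = + 224 / 1 ∷ 0ℚᵘ ∷ 0ℚᵘ ∷ 0ℚᵘ ∷ + 4 / 1 ∷ 0ℚᵘ ∷ 0ℚᵘ ∷ 0ℚᵘ ∷ []
b = 0ℚᵘ ∷ 0ℚᵘ ∷ + 464 / 1 ∷ 0ℚᵘ ∷ 0ℚᵘ ∷ 0ℚᵘ ∷ + 4 / 1 ∷ 0ℚᵘ ∷ []
c = + 160 / 1 ∷ 0ℚᵘ ∷ 0ℚᵘ ∷ 0ℚᵘ ∷ 0ℚᵘ ∷ 0ℚᵘ ∷ 0ℚᵘ ∷ 0ℚᵘ ∷ []
d = 0ℚᵘ ∷ 0ℚᵘ ∷ -[1+ 327 ] / 1 ∷ 0ℚᵘ ∷ 0ℚᵘ ∷ 0ℚᵘ ∷ -[1+ 2 ] / 1 ∷ 0ℚᵘ ∷ []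
e = 0ℚᵘ ∷ 0ℚᵘ ∷ 0ℚᵘ ∷ + 162201600 / 1 ∷ 0ℚᵘ ∷ 0ℚᵘ ∷ 0ℚᵘ ∷ + 1433600 / 1 ∷ []

lemma3p3 : IsomorphicOverK f₁ f₂
lemma3p3 = a , b , c , d , e , det≉0 , e≉0 , transforms
  where
  det≉0 : ¬ (a *K d +K -K (b *K c) ≈K 0K)
  det≉0 = from-no (a *K d +K -K (b *K c) ≈K? 0K)
  e≉0 : ¬ (e ≈K 0K)
  e≉0 = from-no (e ≈K? 0K)
  transforms : scaleP (e *K e) (sexticPoly f₁) ≈P substSextic f₂ a b c d
  transforms = from-yes (scaleP (e *K e) (sexticPoly f₁) ≈P? substSextic f₂ a b c d)
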